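{- Let $n=\prod_{i=1}^k p_i$ be a Carmichael number, with $p_1,\dots,p_k$ distinct odd primes, and let $h$ be the number of $p_i$ with $v_2(p_i-1)=v_2(\lambda(n))$. Then $h\in\{1,2,3,\dots,k-2,k\}$.
   Context: A Carmichael number is a composite integer $n$ with $a^{n-1}\equiv1\pmod n$ for all $a$ coprime to $n$; it is odd and squarefree. $\lambda(n)$ is the Carmichael lambda function (smallest positive $\ell$ with $a^\ell\equiv1\pmod n$ for all $a\in\mathbb{Z}_n^*$), equal to $\mathrm{lcm}(p_1-1,\dots,p_k-1)$ for squarefree $n$ and dividing $n-1$ for Carmichael $n$. $v_2(m)$ is the largest $N$ with $2^N\mid m$. -}

module Defs where

open import Data.Nat using (ℕ; zero; suc; _+_; _*_; _∸_; _^_; _≤_; _<_; _%_; NonZero; _≡ᵇ_)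
open import Data.Nat.Divisibility using (_∣_)
open import Data.Nat.Coprimality using (Coprime)
open import Data.Nat.Primality using (Composite)
open import Data.Bool using (if_then_else_)
open import Data.Product using (_×_)
open import Relation.Nullary using (¬_)
open import Relation.Binary.PropositionalEquality using (_≡_)

IsCarmichael : (n : ℕ) → .{{NonZero n}} → Set
IsCarmichael n = Composite n × (∀ a → Coprime a n → (a ^ (n ∸ 1)) % n ≡ 1 % n)

KillsUnits : (n : ℕ) → .{{NonZero n}} → ℕ → Set
KillsUnits n ℓ = ∀ a → Coprime a n → (a ^ ℓ) % n ≡ 1 % n

IsCarmichaelLambda : (n : ℕ) → .{{NonZero n}} → ℕ → Set
IsCarmichaelLambda n L =
  0 < L × KillsUnits n L × (∀ ℓ → 0 < ℓ → KillsUnits n ℓ → L ≤ ℓ)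

-- 2-adic valuation v₂(m) (with fuel; v₂ 0 = 0 by convention, never used on 0 here)
v₂-fuel : ℕ → ℕ → ℕ
v₂-fuel zero    m = 0
v₂-fuel (suc f) zero = 0
v₂-fuel (suc f) m@(suc _) = if m % 2 ≡ᵇ 0 then suc (v₂-fuel f (Data.Nat._/_ m 2)) else 0

v₂ : ℕ → ℕ
v₂ m = v₂-fuel m m

-- Write λ = 2^N·r and p - 1 = 2^(e_p)·m_p with r and m_p odd; p attains when e_p = N.  Every residue
-- prime to p lifts to a unit of n, so it is killed mod p both by λ and by p - 1.  If e_p > N, the odd
-- factor r can be traded for m_p, so the residue is already killed by (p - 1)/2: then x^((p-1)/2) - 1
-- would have p - 1 roots mod p, which is impossible.  Hence e_p ≤ N for all p.  If e_p < N for all p,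
-- the same trade shows that λ/2 kills every unit mod each p, hence mod n, against minimality: h ≥ 1.
-- Finally n ≡ 1 mod 2^N since λ ∣ n - 1, and every attaining prime is ≡ 1 mod 2^N; if all primes but
-- q attained, q ≡ n ≡ 1 mod 2^N would attain as well: h ≠ k - 1.

module Submission where

open import Defs using (IsCarmichael; IsCarmichaelLambda; KillsUnits; v₂)
open import Data.Nat.Base as ℕ using (ℕ; zero; suc; NonZero)
open import Data.Nat.Primality using (Prime)
open import Data.Nat.ListAction using (product)
open import Data.List.Base using (List; []; _∷_)
open import Data.List.Relation.Unary.All using (All)
open import Data.List.Relation.Unary.Unique.Propositional using (Unique)
open import Relation.Binary.PropositionalEquality
  using (_≡_; _≢_; refl; sym; trans; cong; cong₂; subst; subst₂; module ≡-Reasoning)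

module Congruence where
  open import Data.Integer.Base using (ℤ; +_; _+_; _-_; _*_; -_; _^_; -[1+_]; 0ℤ; 1ℤ)
  import Data.Integer.Base as ℤ
  open import Data.Integer.Properties
    using (^-zeroˡ; abs-*; pos-+; pos-*; +-injective; m-n≡m⊖n; ⊖-≥; neg-distribˡ-*)
  open import Data.Nat.DivMod using (m≡m%n+[m/n]*n; %-congˡ; [m+kn]%n≡m%n)
  open import Data.Integer.Divisibility.Signed
    using (_∣_; divides; ∣-trans; ∣m∣n⇒∣m+n; ∣m∣n⇒∣m-n; ∣m⇒∣-m; ∣m⇒∣m*n; ∣n⇒∣m*n; ∣ᵤ⇒∣; ∣⇒∣ᵤ)
  open import Data.Nat.Primality using (Prime; euclidsLemma)
  open import Data.Sum using (_⊎_; inj₁; inj₂; [_,_]′)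
  open import Relation.Nullary using (¬_; contradiction)
  import Data.Nat.Divisibility as ℕ
  open import Data.Integer.Tactic.RingSolver using (solve-∀)
  open import Relation.Binary.Structures using (IsEquivalence)
  open import Relation.Binary.Bundles using (Setoid)
  import Relation.Binary.Reasoning.Setoid as SetoidReasoning

  infix 4 _≡_mod_

  -- A record rather than a synonym for + m ∣ a - b, so that a and b are inferable from the type.
  record _≡_mod_ (a b : ℤ) (m : ℕ) : Set where
    constructor mod∣
    field ∣-diff : + m ∣ a - b

  open _≡_mod_ public

  module _ {m : ℕ} where

    ≡mod-reflexive : ∀ {a b} → a ≡ b → a ≡ b mod m
    ≡mod-reflexive {a} refl = mod∣ (divides 0ℤ (identity a))
      where identity : ∀ a → a - a ≡ 0ℤ * + m
            identity = solve-∀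

    ≡mod-refl : ∀ {a} → a ≡ a mod m
    ≡mod-refl = ≡mod-reflexive refl

    ≡mod-sym : ∀ {a b} → a ≡ b mod m → b ≡ a mod m
    ≡mod-sym {a} {b} (mod∣ d) = mod∣ (subst (+ m ∣_) (identity a b) (∣m⇒∣-m d))
      where identity : ∀ a b → - (a - b) ≡ b - a
            identity = solve-∀

    ≡mod-trans : ∀ {a b c} → a ≡ b mod m → b ≡ c mod m → a ≡ c mod m
    ≡mod-trans {a} {b} {c} (mod∣ d) (mod∣ e) =
      mod∣ (subst (+ m ∣_) (identity a b c) (∣m∣n⇒∣m+n d e))
      where identity : ∀ a b c → (a - b) + (b - c) ≡ a - c
            identity = solve-∀

    ≡mod-isEquivalence : IsEquivalence (λ a b → a ≡ b mod m)
    ≡mod-isEquivalence = record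
      { refl = ≡mod-refl ; sym = ≡mod-sym ; trans = ≡mod-trans }

    +-cong-≡mod : ∀ {a b c d} → a ≡ b mod m → c ≡ d mod m → a + c ≡ b + d mod m
    +-cong-≡mod {a} {b} {c} {d} (mod∣ x) (mod∣ y) =
      mod∣ (subst (+ m ∣_) (identity a b c d) (∣m∣n⇒∣m+n x y))
      where identity : ∀ a b c d → (a - b) + (c - d) ≡ (a + c) - (b + d)
            identity = solve-∀

    *-cong-≡mod : ∀ {a b c d} → a ≡ b mod m → c ≡ d mod m → a * c ≡ b * d mod m
    *-cong-≡mod {a} {b} {c} {d} (mod∣ x) (mod∣ y) =
      mod∣ (subst (+ m ∣_) (identity a b c d) (∣m∣n⇒∣m+n (∣m⇒∣m*n c x) (∣n⇒∣m*n b y)))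
      where identity : ∀ a b c d → (a - b) * c + b * (c - d) ≡ a * c - b * d
            identity = solve-∀

    +-congˡ-≡mod : ∀ a {b c} → b ≡ c mod m → a + b ≡ a + c mod m
    +-congˡ-≡mod a = +-cong-≡mod (≡mod-refl {a = a})

    *-congˡ-≡mod : ∀ a {b c} → b ≡ c mod m → a * b ≡ a * c mod m
    *-congˡ-≡mod a = *-cong-≡mod (≡mod-refl {a = a})

    ^-cong-≡mod : ∀ {a b} k → a ≡ b mod m → a ^ k ≡ b ^ k mod m
    ^-cong-≡mod zero    _ = ≡mod-refl
    ^-cong-≡mod (suc k) x = *-cong-≡mod x (^-cong-≡mod k x)

    ≡1⇒^≡1 : ∀ {a} k → a ≡ 1ℤ mod m → a ^ k ≡ 1ℤ mod m
    ≡1⇒^≡1 {a} k x = subst (a ^ k ≡_mod m) (^-zeroˡ k) (^-cong-≡mod k x)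

    +-*-≡mod : ∀ a k → a + k * + m ≡ a mod m
    +-*-≡mod a k = mod∣ (divides k (identity a k (+ m)))
      where identity : ∀ a k m → (a + k * m) - a ≡ k * m
            identity = solve-∀

  ≡mod-setoid : ℕ → Setoid _ _
  ≡mod-setoid m = record { isEquivalence = ≡mod-isEquivalence {m} }

  module ≡mod-Reasoning (m : ℕ) = SetoidReasoning (≡mod-setoid m)

  ∣-weaken-≡mod : ∀ {d m a b} → d ℕ.∣ m → a ≡ b mod m → a ≡ b mod d
  ∣-weaken-≡mod d∣m (mod∣ x) = mod∣ (∣-trans (∣ᵤ⇒∣ d∣m) x)

  ∣-resp-≡mod : ∀ {m a b} → a ≡ b mod m → + m ∣ a → + m ∣ b
  ∣-resp-≡mod {m} {a} {b} (mod∣ m∣a-b) m∣a = subst (+ m ∣_) (identity a b) (∣m∣n⇒∣m-n m∣a m∣a-b)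
    where identity : ∀ a b → a - (a - b) ≡ b
          identity = solve-∀

  module _ {p : ℕ} (prime : Prime p) where

    euclid-ℤ : ∀ a b → + p ∣ a * b → + p ∣ a ⊎ + p ∣ b
    euclid-ℤ a b p∣ab with euclidsLemma ℤ.∣ a ∣ ℤ.∣ b ∣ prime (subst (p ℕ.∣_) (abs-* a b) (∣⇒∣ᵤ p∣ab))
    ... | inj₁ p∣a = inj₁ (∣ᵤ⇒∣ p∣a)
    ... | inj₂ p∣b = inj₂ (∣ᵤ⇒∣ p∣b)

    *-cancelˡ-≡mod : ∀ {a b c} → ¬ + p ∣ a → a * b ≡ a * c mod p → b ≡ c mod p
    *-cancelˡ-≡mod {a} {b} {c} p∤a (mod∣ p∣ab-ac) =
      [ (λ p∣a → contradiction p∣a p∤a) , mod∣ ]′ (euclid-ℤ a (b - c) (subst (+ p ∣_) (identity a b c) p∣ab-ac))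
      where identity : ∀ a b c → a * b - a * c ≡ a * (b - c)
            identity = solve-∀

  pos-^ : ∀ a k → + (a ℕ.^ k) ≡ (+ a) ^ k
  pos-^ a zero    = refl
  pos-^ a (suc k) = trans (pos-* a (a ℕ.^ k)) (cong (_*_ (+ a)) (pos-^ a k))

  pos-∸1 : ∀ {x} → 1 ℕ.≤ x → + (x ℕ.∸ 1) ≡ + x - 1ℤ
  pos-∸1 {x} 1≤x = sym (trans (m-n≡m⊖n x 1) (⊖-≥ 1≤x))

  ∣∸1⇒≡1 : ∀ {m x} → 1 ℕ.≤ x → m ℕ.∣ x ℕ.∸ 1 → + x ≡ 1ℤ mod m
  ∣∸1⇒≡1 1≤x m∣x-1 = mod∣ (subst (+ _ ∣_) (pos-∸1 1≤x) (∣ᵤ⇒∣ m∣x-1))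

  ≡1⇒∣∸1 : ∀ {m x} → 1 ℕ.≤ x → + x ≡ 1ℤ mod m → m ℕ.∣ x ℕ.∸ 1
  ≡1⇒∣∸1 1≤x (mod∣ m∣x-1) = ∣⇒∣ᵤ (subst (+ _ ∣_) (sym (pos-∸1 1≤x)) m∣x-1)

  private
    a≡b+[a-b] : ∀ a b → a ≡ b + (a - b)
    a≡b+[a-b] = solve-∀

    b-a≡-[a-b] : ∀ a b → b - a ≡ - (a - b)
    b-a≡-[a-b] = solve-∀

  module _ {m : ℕ} .{{_ : NonZero m}} where

    ≡%-≡mod : ∀ x → + x ≡ + (x ℕ.% m) mod m
    ≡%-≡mod x = subst (λ z → z ≡ + (x ℕ.% m) mod m) expand (+-*-≡mod (+ (x ℕ.% m)) (+ (x ℕ./ m)))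
      where expand : + (x ℕ.% m) + + (x ℕ./ m) * + m ≡ + x
            expand = trans (cong (_+_ (+ (x ℕ.% m))) (sym (pos-* (x ℕ./ m) m)))
                           (trans (sym (pos-+ (x ℕ.% m) _)) (cong +_ (sym (m≡m%n+[m/n]*n x m))))

    %≡%⇒≡mod : ∀ {x y} → x ℕ.% m ≡ y ℕ.% m → + x ≡ + y mod m
    %≡%⇒≡mod {x} {y} x%m≡y%m = begin
      + x           ≈⟨ ≡%-≡mod x ⟩
      + (x ℕ.% m)   ≡⟨ cong +_ x%m≡y%m ⟩
      + (y ℕ.% m)   ≈⟨ ≡mod-sym (≡%-≡mod y) ⟩
      + y           ∎
      where open ≡mod-Reasoning m

    ≡mod⇒%≡% : ∀ {x y} → + x ≡ + y mod m → x ℕ.% m ≡ y ℕ.% m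
    ≡mod⇒%≡% {x} {y} (mod∣ (divides (+ k) x-y≡km)) = trans (%-congˡ x≡y+km) ([m+kn]%n≡m%n y k m)
      where x≡y+km : x ≡ y ℕ.+ k ℕ.* m
            x≡y+km = +-injective (begin
              + x                   ≡⟨ a≡b+[a-b] (+ x) (+ y) ⟩
              + y + (+ x - + y)     ≡⟨ cong (_+_ (+ y)) x-y≡km ⟩
              + y + + k * + m       ≡⟨ cong (_+_ (+ y)) (sym (pos-* k m)) ⟩
              + y + + (k ℕ.* m)     ≡⟨ sym (pos-+ y (k ℕ.* m)) ⟩
              + (y ℕ.+ k ℕ.* m)     ∎)
              where open ≡-Reasoning
    ≡mod⇒%≡% {x} {y} (mod∣ (divides -[1+ k ] x-y≡km)) = sym (trans (%-congˡ y≡x+km) ([m+kn]%n≡m%n x (suc k) m))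
      where y≡x+km : y ≡ x ℕ.+ suc k ℕ.* m
            y≡x+km = +-injective (begin
              + y                             ≡⟨ a≡b+[a-b] (+ y) (+ x) ⟩
              + x + (+ y - + x)               ≡⟨ cong (_+_ (+ x)) (b-a≡-[a-b] (+ x) (+ y)) ⟩
              + x + - (+ x - + y)             ≡⟨ cong (λ d → + x + - d) x-y≡km ⟩
              + x + - (-[1+ k ] * + m)        ≡⟨ cong (_+_ (+ x)) (neg-distribˡ-* -[1+ k ] (+ m)) ⟩
              + x + + suc k * + m             ≡⟨ cong (_+_ (+ x)) (sym (pos-* (suc k) m)) ⟩
              + x + + (suc k ℕ.* m)           ≡⟨ sym (pos-+ x (suc k ℕ.* m)) ⟩
              + (x ℕ.+ suc k ℕ.* m)           ∎)
              where open ≡-Reasoning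

module Fermat where
  open import Data.Nat.Base
  open import Data.Nat.Properties
  open import Data.Nat.Divisibility
  open import Data.Nat.Primality using (Prime; prime; euclidsLemma; ¬prime[0])
  open import Data.Nat.Combinatorics
  open import Data.Nat.Tactic.RingSolver using (solve-∀)
  open import Data.Fin.Base using (Fin; zero; suc; toℕ; inject₁; fromℕ)
  open import Data.Fin.Properties using (toℕ<n; toℕ-inject₁; toℕ-fromℕ)
  open import Data.Vec.Functional using (Vector; init; tail; last)
  open import Data.Product using (∃-syntax; _×_; _,_)
  open import Data.Sum using (inj₁; inj₂)
  open import Relation.Nullary using (contradiction)
  import Algebra.Properties.CommutativeSemiring.Binomial +-*-commutativeSemiring as Binomial
  import Algebra.Properties.Semiring.Exp +-*-semiring as Exp
  import Algebra.Properties.Semiring.Mult +-*-semiring as Mult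
  open import Algebra.Properties.Monoid.Sum +-0-monoid using (sum; sum-init-last)

  nC0≡1 : ∀ n → n C 0 ≡ 1
  nC0≡1 n = trans (nCk≡nC[n∸k] {0} {n} z≤n) (nCn≡1 n)

  [1+k]*[1+n]C[1+k]≡[1+n]*nCk : ∀ n k → suc k * (suc n C suc k) ≡ suc n * (n C k)
  [1+k]*[1+n]C[1+k]≡[1+n]*nCk zero    zero    = refl
  [1+k]*[1+n]C[1+k]≡[1+n]*nCk zero    (suc k) = *-zeroʳ (suc (suc k))
  [1+k]*[1+n]C[1+k]≡[1+n]*nCk (suc n) zero    = begin
    1 * (suc (suc n) C 1)     ≡⟨ trans (*-identityˡ _) (nC1≡n (suc (suc n))) ⟩
    suc (suc n)               ≡⟨ sym (*-identityʳ (suc (suc n))) ⟩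
    suc (suc n) * 1           ≡⟨ cong (suc (suc n) *_) (sym (nC0≡1 (suc n))) ⟩
    suc (suc n) * (suc n C 0) ∎
    where open ≡-Reasoning
  [1+k]*[1+n]C[1+k]≡[1+n]*nCk (suc n) (suc k) = begin
    suc (suc k) * (suc (suc n) C suc (suc k))            ≡⟨ cong (suc (suc k) *_) (sym (nCk+nC[k+1]≡[n+1]C[k+1] (suc n) (suc k))) ⟩
    suc (suc k) * (A + B)                                ≡⟨ regroup A B k ⟩
    (suc k * A + A) + suc (suc k) * B                    ≡⟨ cong₂ (λ u v → u + A + v) ([1+k]*[1+n]C[1+k]≡[1+n]*nCk n k)
                                                                                 ([1+k]*[1+n]C[1+k]≡[1+n]*nCk n (suc k)) ⟩
    (suc n * (n C k) + A) + suc n * (n C suc k)          ≡⟨ collect (n C k) (n C suc k) A n ⟩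
    suc n * (n C k + n C suc k) + A                      ≡⟨ cong (λ u → suc n * u + A) (nCk+nC[k+1]≡[n+1]C[k+1] n k) ⟩
    suc n * A + A                                        ≡⟨ +-comm (suc n * A) A ⟩
    suc (suc n) * A                                      ∎
    where
    open ≡-Reasoning
    A = suc n C suc k
    B = suc n C suc (suc k)
    regroup : ∀ a b k → suc (suc k) * (a + b) ≡ (suc k * a + a) + suc (suc k) * b
    regroup = solve-∀
    collect : ∀ x y a n → (suc n * x + a) + suc n * y ≡ suc n * (x + y) + a
    collect = solve-∀

  prime∣pCk : ∀ {p k} → Prime p → 0 < k → k < p → p ∣ p C k
  prime∣pCk {zero}  prime[p] _ _ = contradiction prime[p] ¬prime[0]
  prime∣pCk {suc n} {suc k} prime[p] _ k<p
    with euclidsLemma (suc k) (suc n C suc k) prime[p]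
           (divides (n C k) (trans ([1+k]*[1+n]C[1+k]≡[1+n]*nCk n k) (*-comm (suc n) (n C k))))
  ... | inj₁ p∣k = contradiction (∣⇒≤ p∣k) (<⇒≱ k<p)
  ... | inj₂ p∣C = p∣C

  private
    ^≡Exp^ : ∀ x n → x Exp.^ n ≡ x ^ n
    ^≡Exp^ x zero    = refl
    ^≡Exp^ x (suc n) = cong (x *_) (^≡Exp^ x n)

    ×≡* : ∀ n x → n Mult.× x ≡ n * x
    ×≡* zero    x = refl
    ×≡* (suc n) x = cong (x +_) (×≡* n x)

    ∣-sum : ∀ {d m} (t : Vector ℕ m) → (∀ i → d ∣ t i) → d ∣ sum t
    ∣-sum {m = zero}  t _     = _ ∣0
    ∣-sum {m = suc m} t d∣t = ∣m∣n⇒∣m+n (d∣t zero) (∣-sum (tail t) (λ i → d∣t (suc i)))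

  freshman's-dream : ∀ {p} → Prime p → ∀ x → ∃[ m ] p ∣ m × (x + 1) ^ p ≡ 1 + m + x ^ p
  freshman's-dream {0}           (prime {{()}} _)
  freshman's-dream {1}           (prime {{()}} _)
  freshman's-dream {suc (suc q)} prime[p] x = sum middle , ∣-sum middle p∣middle , expansion
    where
    p = suc (suc q)
    term : Fin (suc p) → ℕ
    term = Binomial.binomialTerm x 1 p
    middle = init (tail term)

    p∣middle : ∀ i → p ∣ middle i
    p∣middle i = subst (p ∣_) (sym (×≡* (p C toℕ (suc (inject₁ i))) _))
      (∣m⇒∣m*n _ (prime∣pCk prime[p] (s≤s z≤n)
        (s≤s (subst (_< suc q) (sym (toℕ-inject₁ i)) (toℕ<n i)))))

    first : term zero ≡ 1
    first = begin
      (p C 0) Mult.× (x Exp.^ 0 * 1 Exp.^ p)    ≡⟨ ×≡* (p C 0) _ ⟩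
      (p C 0) * (1 * 1 Exp.^ p)                 ≡⟨ cong₂ _*_ (nC0≡1 p) (trans (*-identityˡ _) (^≡Exp^ 1 p)) ⟩
      1 * 1 ^ p                                 ≡⟨ trans (*-identityˡ _) (^-zeroˡ p) ⟩
      1                                         ∎
      where open ≡-Reasoning

    final : last (tail term) ≡ x ^ p
    final = begin
      (p C k) Mult.× (x Exp.^ k * 1 Exp.^ (p ∸ k))   ≡⟨ cong (λ k → (p C k) Mult.× (x Exp.^ k * 1 Exp.^ (p ∸ k))) (toℕ-fromℕ p) ⟩
      (p C p) Mult.× (x Exp.^ p * 1 Exp.^ (p ∸ p))   ≡⟨ ×≡* (p C p) _ ⟩
      (p C p) * (x Exp.^ p * 1 Exp.^ (p ∸ p))        ≡⟨ cong₂ _*_ (nCn≡1 p) (cong₂ _*_ (^≡Exp^ x p) (cong (1 Exp.^_) (n∸n≡0 p))) ⟩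
      1 * (x ^ p * 1)                                ≡⟨ trans (*-identityˡ _) (*-identityʳ _) ⟩
      x ^ p                                          ∎
      where open ≡-Reasoning
            k = toℕ (fromℕ p)

    expansion : (x + 1) ^ p ≡ 1 + sum middle + x ^ p
    expansion = begin
      (x + 1) ^ p                                ≡⟨ sym (^≡Exp^ (x + 1) p) ⟩
      (x + 1) Exp.^ p                            ≡⟨ Binomial.theorem p x 1 ⟩
      term zero + sum (tail term)                ≡⟨ cong₂ _+_ first (sum-init-last (tail term)) ⟩
      1 + (sum middle + last (tail term))        ≡⟨ sym (+-assoc 1 (sum middle) _) ⟩
      1 + sum middle + last (tail term)          ≡⟨ cong (1 + sum middle +_) final ⟩
      1 + sum middle + x ^ p                     ∎
      where open ≡-Reasoning

  fermat's-little : ∀ {p} → Prime p → ∀ x → ∃[ k ] x ^ p ≡ x + k * p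
  fermat's-little {zero}  (prime {{()}} _)
  fermat's-little {suc q} prime[p] zero = 0 , refl
  fermat's-little {suc q} prime[p] (suc x)
    with k , x^p≡x+kp ← fermat's-little prime[p] x
       | m , divides j m≡jp , [x+1]^p≡1+m+x^p ← freshman's-dream prime[p] x
    = j + k , (begin
      suc x ^ p                  ≡⟨ cong (_^ p) (+-comm 1 x) ⟩
      (x + 1) ^ p                ≡⟨ [x+1]^p≡1+m+x^p ⟩
      1 + m + x ^ p              ≡⟨ cong₂ (λ u v → 1 + u + v) m≡jp x^p≡x+kp ⟩
      1 + j * p + (x + k * p)    ≡⟨ collect j k x p ⟩
      suc x + (j + k) * p        ∎)
    where
    open ≡-Reasoning
    p = suc q
    collect : ∀ j k x p → 1 + j * p + (x + k * p) ≡ suc x + (j + k) * p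
    collect = solve-∀

module PrimeModulus where
  open import Data.Integer.Base using (ℤ; +_; _+_; _-_; _*_; -_; _^_; 0ℤ; 1ℤ; -1ℤ)
  open import Data.Integer.Properties
    using (*-identityʳ; *-zeroʳ; +-identityʳ; +-identityˡ; +-comm; pos-+; pos-*; m-n≡m⊖n; ⊖-≥)
  open import Data.Integer.Divisibility.Signed using (_∣_; ∣⇒∣ᵤ)
  open import Data.Integer.Tactic.RingSolver using (solve-∀)
  import Data.Nat.Base as ℕ
  import Data.Nat.Properties as ℕ
  import Data.Nat.Divisibility as ℕ
  open import Data.Nat.Primality using (Prime; prime; ¬prime[1])
  open import Data.List.Base using (List; []; _∷_; length; applyUpTo)
  open import Data.List.Properties using (length-applyUpTo)
  open import Data.List.Relation.Unary.All using (All; []; _∷_; zipWith)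
  import Data.List.Relation.Unary.All.Properties as All
  open import Data.List.Relation.Unary.AllPairs using (AllPairs; []; _∷_)
  import Data.List.Relation.Unary.AllPairs.Properties as AllPairs
  open import Data.Product using (_,_)
  open import Relation.Nullary using (¬_)
  open Congruence
  open Fermat using (fermat's-little)

  fermat-unit : ∀ {p a} → Prime p → ¬ p ℕ.∣ a → (+ a) ^ (p ℕ.∸ 1) ≡ 1ℤ mod p
  fermat-unit {zero}  (prime {{()}} _)
  fermat-unit {suc q} {a} prime[p] p∤a with k , a^p≡a+kp ← fermat's-little prime[p] a =
    *-cancelˡ-≡mod prime[p] {+ a} (λ p∣a → p∤a (∣⇒∣ᵤ p∣a)) (begin
      + a * (+ a) ^ q                 ≡⟨ sym (pos-^ a (suc q)) ⟩
      + (a ℕ.^ suc q)                 ≡⟨ cong +_ a^p≡a+kp ⟩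
      + (a ℕ.+ k ℕ.* suc q)           ≡⟨ trans (pos-+ a _) (cong (_+_ (+ a)) (pos-* k (suc q))) ⟩
      + a + + k * + suc q             ≈⟨ +-*-≡mod (+ a) (+ k) ⟩
      + a                             ≡⟨ sym (*-identityʳ (+ a)) ⟩
      + a * 1ℤ                        ∎)
    where open ≡mod-Reasoning (suc q)

  eval : List ℤ → ℤ → ℤ
  eval []       x = 0ℤ
  eval (c ∷ cs) x = c + x * eval cs x

  divide : ℤ → List ℤ → List ℤ
  divide r []            = []
  divide r (c ∷ [])      = []
  divide r (c ∷ c′ ∷ cs) = eval (c′ ∷ cs) r ∷ divide r (c′ ∷ cs)

  length-divide : ∀ r c cs → length (divide r (c ∷ cs)) ≡ length cs
  length-divide r c []        = refl
  length-divide r c (c′ ∷ cs) = cong ℕ.suc (length-divide r c′ cs)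

  eval-divide : ∀ r cs x → eval cs x ≡ (x - r) * eval (divide r cs) x + eval cs r
  eval-divide r []            x = identity x r
    where identity : ∀ x r → 0ℤ ≡ (x - r) * 0ℤ + 0ℤ
          identity = solve-∀
  eval-divide r (c ∷ [])      x = identity c x r
    where identity : ∀ c x r → c + x * 0ℤ ≡ (x - r) * 0ℤ + (c + r * 0ℤ)
          identity = solve-∀
  eval-divide r (c ∷ c′ ∷ cs) x =
    trans (cong (λ v → c + x * v) (eval-divide r (c′ ∷ cs) x))
          (identity c x r (eval (divide r (c′ ∷ cs)) x) (eval (c′ ∷ cs) r))
    where identity : ∀ c x r q v → c + x * ((x - r) * q + v) ≡ (x - r) * (v + x * q) + (c + r * v)
          identity = solve-∀

  monomial : ℕ → List ℤ
  monomial zero    = 1ℤ ∷ []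
  monomial (suc j) = 0ℤ ∷ monomial j

  eval-monomial : ∀ j x → eval (monomial j) x ≡ x ^ j
  eval-monomial zero    x = trans (cong (_+_ 1ℤ) (*-zeroʳ x)) (+-identityʳ 1ℤ)
  eval-monomial (suc j) x = trans (+-identityˡ _) (cong (x *_) (eval-monomial j x))

  length-monomial : ∀ j → length (monomial j) ≡ suc j
  length-monomial zero    = refl
  length-monomial (suc j) = cong suc (length-monomial j)

  module _ {p : ℕ} (prime[p] : Prime p) where

    lagrange : ∀ cs rs → length rs ≡ length cs → AllPairs (λ r s → ¬ r ≡ s mod p) rs →
               All (λ r → eval cs r ≡ 0ℤ mod p) rs → ∀ x → eval cs x ≡ 0ℤ mod p
    lagrange []       rs       _   _              _                x = ≡mod-refl
    lagrange (c ∷ cs) (r ∷ rs) |rs| (r≢rs ∷ rs-distinct) (root-r ∷ roots) x = begin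
      eval (c ∷ cs) x                      ≡⟨ eval-divide r (c ∷ cs) x ⟩
      (x - r) * eval q x + eval (c ∷ cs) r ≈⟨ +-cong-≡mod (*-congˡ-≡mod (x - r) (q-vanishes x)) root-r ⟩
      (x - r) * 0ℤ + 0ℤ                    ≡⟨ identity (x - r) ⟩
      0ℤ                                   ∎
      where
      open ≡mod-Reasoning p
      q = divide r (c ∷ cs)
      identity : ∀ a → a * 0ℤ + 0ℤ ≡ 0ℤ
      identity = solve-∀
      q-root : ∀ {s} → ¬ r ≡ s mod p → eval (c ∷ cs) s ≡ 0ℤ mod p → eval q s ≡ 0ℤ mod p
      q-root {s} r≢s root-s = *-cancelˡ-≡mod prime[p] {s - r} (λ p∣s-r → r≢s (≡mod-sym (mod∣ p∣s-r))) (begin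
        (s - r) * eval q s                       ≡⟨ sym (+-identityʳ _) ⟩
        (s - r) * eval q s + 0ℤ                  ≈⟨ +-congˡ-≡mod ((s - r) * eval q s) (≡mod-sym root-r) ⟩
        (s - r) * eval q s + eval (c ∷ cs) r     ≡⟨ sym (eval-divide r (c ∷ cs) s) ⟩
        eval (c ∷ cs) s                          ≈⟨ root-s ⟩
        0ℤ                                       ≡⟨ sym (*-zeroʳ (s - r)) ⟩
        (s - r) * 0ℤ                             ∎)
      q-vanishes : ∀ x → eval q x ≡ 0ℤ mod p
      q-vanishes = lagrange q rs (trans (ℕ.suc-injective |rs|) (sym (length-divide r c cs)))
                            rs-distinct (zipWith (λ (r≢s , root-s) → q-root r≢s root-s) (r≢rs , roots))

    distinct-residues : ∀ {i j} → i ℕ.< j → j ℕ.< p → ¬ + i ≡ + j mod p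
    distinct-residues {i} {j} i<j j<p i≡j = ℕ.<⇒≱ (ℕ.≤-<-trans (ℕ.m∸n≤m j i) j<p) (ℕ.∣⇒≤ p∣j-i)
      where
      instance _ = ℕ.>-nonZero (ℕ.m<n⇒0<n∸m i<j)
      p∣j-i : p ℕ.∣ j ℕ.∸ i
      p∣j-i = ∣⇒∣ᵤ (subst (+ p ∣_) (trans (m-n≡m⊖n j i) (⊖-≥ (ℕ.<⇒≤ i<j))) (∣-diff (≡mod-sym i≡j)))

    ¬x^d≡1-on-[1,1+d] : ∀ {d} → 0 ℕ.< d → ℕ.suc d ℕ.< p →
                        ¬ (∀ x → 0 ℕ.< x → x ℕ.≤ ℕ.suc d → (+ x) ^ d ≡ 1ℤ mod p)
    ¬x^d≡1-on-[1,1+d] {ℕ.suc j} _ 1+d<p x^d≡1 =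
      ¬prime[1] (subst Prime (ℕ.∣1⇒≡1 (∣⇒∣ᵤ (∣-diff −1≡0))) prime[p])
      where
      open ≡mod-Reasoning p
      d = ℕ.suc j
      xᵈ-1 = -1ℤ ∷ monomial j
      eval-xᵈ-1 : ∀ x → eval xᵈ-1 x ≡ x ^ d - 1ℤ
      eval-xᵈ-1 x = trans (cong (λ v → -1ℤ + x * v) (eval-monomial j x)) (+-comm -1ℤ (x * x ^ j))
      point : ℕ → ℤ
      point i = + ℕ.suc i
      points = applyUpTo point (ℕ.suc d)
      roots : All (λ r → eval xᵈ-1 r ≡ 0ℤ mod p) points
      roots = All.applyUpTo⁺₁ point (ℕ.suc d) λ {i} i<1+d → begin
        eval xᵈ-1 (+ ℕ.suc i)      ≡⟨ eval-xᵈ-1 (+ ℕ.suc i) ⟩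
        (+ ℕ.suc i) ^ d - 1ℤ       ≈⟨ +-cong-≡mod (x^d≡1 (ℕ.suc i) (ℕ.s≤s ℕ.z≤n) i<1+d) (≡mod-refl {a = - 1ℤ}) ⟩
        1ℤ - 1ℤ                    ≡⟨⟩
        0ℤ                         ∎
      distinct : AllPairs (λ r s → ¬ r ≡ s mod p) points
      distinct = AllPairs.applyUpTo⁺₁ point (ℕ.suc d)
        λ i<j j<1+d → distinct-residues (ℕ.s≤s i<j) (ℕ.<-≤-trans (ℕ.s≤s j<1+d) 1+d<p)
      −1≡0 : -1ℤ ≡ 0ℤ mod p
      −1≡0 = lagrange xᵈ-1 points (trans (length-applyUpTo point (ℕ.suc d)) (cong ℕ.suc (sym (length-monomial j))))
                       distinct roots 0ℤ

module TwoAdic where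
  open import Defs using (v₂-fuel; v₂)
  open import Data.Nat.Base
  open import Data.Nat.Properties
  open import Data.Nat.Divisibility
  open import Data.Nat.DivMod using (m/n<m; m/n*n≡m; m%n<n; m≡m%n+[m/n]*n; m≥n⇒m/n>0)
  open import Data.Bool.Base using (true; false; T)
  open import Data.Product using (∃-syntax; _×_; _,_)
  open import Relation.Nullary using (¬_; contradiction; yes; no)

  Odd : ℕ → Set
  Odd n = ¬ 2 ∣ n

  odd⇒1+2* : ∀ {u} → Odd u → ∃[ w ] u ≡ suc (2 * w)
  odd⇒1+2* {u} u-odd with u % 2 | m%n<n u 2 | m≡m%n+[m/n]*n u 2
  ... | 0 | _                 | u≡[u/2]*2   = contradiction (divides (u / 2) u≡[u/2]*2) u-odd
  ... | 1 | _                 | u≡1+[u/2]*2 = u / 2 , trans u≡1+[u/2]*2 (cong suc (*-comm (u / 2) 2))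
  ... | suc (suc _) | s≤s (s≤s ()) | _

  odd⇒>0 : ∀ {u} → Odd u → 0 < u
  odd⇒>0 {zero}  u-odd = contradiction (2 ∣0) u-odd
  odd⇒>0 {suc u} _     = z<s

  ^-split : ∀ x {a b} → a ≤ b → x ^ b ≡ x ^ a * x ^ (b ∸ a)
  ^-split x {a} a≤b = trans (cong (x ^_) (sym (m+[n∸m]≡n a≤b))) (^-distribˡ-+-* x a _)

  ^-monoʳ-∣ : ∀ x {a b} → a ≤ b → x ^ a ∣ x ^ b
  ^-monoʳ-∣ x {a} {b} a≤b = divides (x ^ (b ∸ a)) (trans (^-split x a≤b) (*-comm (x ^ a) _))

  v₂-fuel-decomposition : ∀ f {m} → 0 < m → m ≤ f → ∃[ o ] Odd o × m ≡ 2 ^ v₂-fuel f m * o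
  v₂-fuel-decomposition (suc f) {m@(suc _)} _ m≤1+f with m % 2 ≡ᵇ 0 in m%2≡ᵇ0
  ... | false = m , m-odd , sym (*-identityˡ m)
    where
    m-odd : Odd m
    m-odd 2∣m = subst T m%2≡ᵇ0 (≡⇒≡ᵇ _ 0 (n∣m⇒m%n≡0 m 2 2∣m))
  ... | true = even-case (m%n≡0⇒n∣m m 2 (≡ᵇ⇒≡ _ 0 (subst T (sym m%2≡ᵇ0) _)))
    where
    even-case : 2 ∣ m → ∃[ o ] Odd o × m ≡ 2 ^ suc (v₂-fuel f (m / 2)) * o
    even-case 2∣m with o , o-odd , m/2≡ ← v₂-fuel-decomposition f (m≥n⇒m/n>0 (∣⇒≤ 2∣m))
                                              (≤-pred (≤-trans (m/n<m m 2 (s≤s (s≤s z≤n))) m≤1+f))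
      = o , o-odd , (begin
        m                                ≡⟨ sym (m/n*n≡m 2∣m) ⟩
        m / 2 * 2                        ≡⟨ cong (_* 2) m/2≡ ⟩
        2 ^ v₂-fuel f (m / 2) * o * 2    ≡⟨ *-comm (2 ^ v₂-fuel f (m / 2) * o) 2 ⟩
        2 * (2 ^ v₂-fuel f (m / 2) * o)  ≡⟨ sym (*-assoc 2 (2 ^ v₂-fuel f (m / 2)) o) ⟩
        2 ^ suc (v₂-fuel f (m / 2)) * o  ∎)
      where open ≡-Reasoning

  v₂-decomposition : ∀ {m} → 0 < m → ∃[ o ] Odd o × m ≡ 2 ^ v₂ m * o
  v₂-decomposition {m} 0<m = v₂-fuel-decomposition m 0<m ≤-refl

  2^v₂∣ : ∀ {m} → 0 < m → 2 ^ v₂ m ∣ m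
  2^v₂∣ 0<m with o , _ , m≡ ← v₂-decomposition 0<m = divides o (trans m≡ (*-comm _ o))

  2^a∣⇒a≤v₂ : ∀ {a m} → 0 < m → 2 ^ a ∣ m → a ≤ v₂ m
  2^a∣⇒a≤v₂ {a} {m} 0<m 2^a∣m with a ≤? v₂ m
  ... | yes a≤v₂m = a≤v₂m
  ... | no  a≰v₂m with o , o-odd , m≡ ← v₂-decomposition 0<m =
    contradiction (*-cancelˡ-∣ (2 ^ v₂ m) {{m^n≢0 2 (v₂ m)}} 2^v₂*2∣2^v₂*o) o-odd
    where
    2^v₂*2∣2^v₂*o : 2 ^ v₂ m * 2 ∣ 2 ^ v₂ m * o
    2^v₂*2∣2^v₂*o = subst₂ _∣_ (*-comm 2 (2 ^ v₂ m)) m≡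
      (∣-trans (^-monoʳ-∣ 2 (≰⇒> a≰v₂m)) 2^a∣m)

module ExponentHalving where
  open import Data.Integer.Base using (ℤ; _*_; _^_; 1ℤ)
  open import Data.Integer.Properties using (*-identityʳ; ^-*-assoc; ^-distribˡ-+-*)
  import Data.Nat.Base as ℕ
  import Data.Nat.Properties as ℕ
  open import Data.Nat.Tactic.RingSolver using (solve-∀)
  open import Data.Product using (_,_)
  open Congruence
  open TwoAdic using (Odd; odd⇒1+2*; ^-split)

  module _ {m : ℕ} {z : ℤ} where
    open ≡mod-Reasoning m

    odd-halving : ∀ {u} s → Odd u → z ^ u ≡ 1ℤ mod m → z ^ (2 ℕ.* s) ≡ 1ℤ mod m → z ^ s ≡ 1ℤ mod m
    odd-halving s u-odd z^u≡1 z^2s≡1 with w , refl ← odd⇒1+2* u-odd = begin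
      z ^ s                                ≡⟨ sym (*-identityʳ (z ^ s)) ⟩
      z ^ s * 1ℤ                           ≈⟨ *-congˡ-≡mod (z ^ s) (≡mod-sym (≡1⇒^≡1 w z^2s≡1)) ⟩
      z ^ s * (z ^ (2 ℕ.* s)) ^ w          ≡⟨ cong (z ^ s *_) (^-*-assoc z (2 ℕ.* s) w) ⟩
      z ^ s * z ^ (2 ℕ.* s ℕ.* w)          ≡⟨ sym (^-distribˡ-+-* z s _) ⟩
      z ^ (s ℕ.+ 2 ℕ.* s ℕ.* w)            ≡⟨ cong (z ^_) (regroup s w) ⟩
      z ^ (ℕ.suc (2 ℕ.* w) ℕ.* s)          ≡⟨ sym (^-*-assoc z (ℕ.suc (2 ℕ.* w)) s) ⟩
      (z ^ ℕ.suc (2 ℕ.* w)) ^ s            ≈⟨ ≡1⇒^≡1 s z^u≡1 ⟩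
      1ℤ                                   ∎
      where regroup : ∀ s w → s ℕ.+ 2 ℕ.* s ℕ.* w ≡ ℕ.suc (2 ℕ.* w) ℕ.* s
            regroup = solve-∀

  halve-exponent : ∀ {m y} i {j s u} → j ℕ.≤ i → Odd u →
                   y ^ (2 ℕ.^ ℕ.suc i ℕ.* s) ≡ 1ℤ mod m →
                   y ^ (2 ℕ.^ j ℕ.* u) ≡ 1ℤ mod m →
                   y ^ (2 ℕ.^ i ℕ.* s) ≡ 1ℤ mod m
  halve-exponent {m} {y} i {j} {s} {u} j≤i u-odd y^2^[1+i]s≡1 y^2^ju≡1 = begin
    y ^ (2 ℕ.^ i ℕ.* s)    ≡⟨ sym (^-*-assoc y (2 ℕ.^ i) s) ⟩
    z ^ s                  ≈⟨ odd-halving s u-odd z^u≡1 z^2s≡1 ⟩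
    1ℤ                     ∎
    where
    open ≡mod-Reasoning m
    z = y ^ (2 ℕ.^ i)
    z^2s≡1 : z ^ (2 ℕ.* s) ≡ 1ℤ mod m
    z^2s≡1 = begin
      z ^ (2 ℕ.* s)                  ≡⟨ ^-*-assoc y (2 ℕ.^ i) (2 ℕ.* s) ⟩
      y ^ (2 ℕ.^ i ℕ.* (2 ℕ.* s))    ≡⟨ cong (y ^_) (regroup (2 ℕ.^ i) s) ⟩
      y ^ (2 ℕ.^ ℕ.suc i ℕ.* s)      ≈⟨ y^2^[1+i]s≡1 ⟩
      1ℤ                             ∎
      where regroup : ∀ a s → a ℕ.* (2 ℕ.* s) ≡ 2 ℕ.* a ℕ.* s
            regroup = solve-∀
    z^u≡1 : z ^ u ≡ 1ℤ mod m
    z^u≡1 = begin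
      z ^ u                                      ≡⟨ ^-*-assoc y (2 ℕ.^ i) u ⟩
      y ^ (2 ℕ.^ i ℕ.* u)                        ≡⟨ cong (λ e → y ^ (e ℕ.* u)) (^-split 2 j≤i) ⟩
      y ^ (2 ℕ.^ j ℕ.* 2 ℕ.^ (i ℕ.∸ j) ℕ.* u)    ≡⟨ cong (y ^_) (regroup (2 ℕ.^ j) (2 ℕ.^ (i ℕ.∸ j)) u) ⟩
      y ^ (2 ℕ.^ j ℕ.* u ℕ.* 2 ℕ.^ (i ℕ.∸ j))    ≡⟨ sym (^-*-assoc y (2 ℕ.^ j ℕ.* u) _) ⟩
      (y ^ (2 ℕ.^ j ℕ.* u)) ^ 2 ℕ.^ (i ℕ.∸ j)    ≈⟨ ≡1⇒^≡1 (2 ℕ.^ (i ℕ.∸ j)) y^2^ju≡1 ⟩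
      1ℤ                                         ∎
      where regroup : ∀ a b u → a ℕ.* b ℕ.* u ≡ a ℕ.* u ℕ.* b
            regroup = solve-∀

module SquarefreeProduct where
  open import Data.Nat.Base
  open import Data.Nat.Properties
  open import Data.Nat.Divisibility
  open import Data.Nat.Coprimality using (Coprime; coprime-divisor)
  open import Data.Nat.Primality using (Prime; prime⇒irreducible; euclidsLemma; ¬prime[1])
  open import Data.Nat.Primality.Factorisation using (factorisationHasAllPrimeFactors)
  open import Data.Nat.ListAction using (product)
  open import Data.List.Base using (List; []; _∷_)
  open import Data.List.Membership.Propositional using (_∈_; _∉_)
  open import Data.List.Relation.Unary.Any using (here; there)
  open import Data.List.Relation.Unary.All as All using (All; []; _∷_)
  open import Data.List.Relation.Unary.AllPairs using (_∷_)
  open import Data.List.Relation.Unary.Unique.Propositional using (Unique)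
  open import Data.List.Relation.Unary.Unique.Propositional.Properties using (Unique[x∷xs]⇒x∉xs)
  open import Data.Product using (∃-syntax; _×_; _,_)
  open import Data.Sum using (inj₁; inj₂)
  open import Relation.Nullary using (¬_; contradiction)
  open import Data.Integer.Divisibility.Signed using (∣ᵤ⇒∣; ∣⇒∣ᵤ)
  open Congruence using (_≡_mod_; mod∣)

  prime∤⇒coprime : ∀ {p m} → Prime p → ¬ p ∣ m → Coprime p m
  prime∤⇒coprime prime[p] p∤m (d∣p , d∣m) with prime⇒irreducible prime[p] d∣p
  ... | inj₁ d≡1    = d≡1
  ... | inj₂ refl   = contradiction d∣m p∤m

  coprime-*ʳ : ∀ {a m n} → Coprime a m → Coprime a n → Coprime a (m * n)
  coprime-*ʳ a⊥m a⊥n (d∣a , d∣mn) =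
    a⊥n (d∣a , coprime-divisor (λ (e∣d , e∣m) → a⊥m (∣-trans e∣d d∣a , e∣m)) d∣mn)

  coprime⇒*-∣ : ∀ {m n o} → Coprime m n → m ∣ o → n ∣ o → m * n ∣ o
  coprime⇒*-∣ {m} {n} m⊥n m∣o (divides q o≡qn)
    with divides r q≡rm ← coprime-divisor m⊥n (subst (m ∣_) (trans o≡qn (*-comm q n)) m∣o)
    = divides r (trans o≡qn (trans (cong (_* n) q≡rm) (*-assoc r m n)))

  prime∤product : ∀ {p qs} → Prime p → All Prime qs → p ∉ qs → ¬ p ∣ product qs
  prime∤product prime[p] primes p∉qs p∣∏ = p∉qs (factorisationHasAllPrimeFactors prime[p] p∣∏ primes)

  product-∣ : ∀ {ps o} → Unique ps → All Prime ps → All (_∣ o) ps → product ps ∣ o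
  product-∣ {[]}     _    _                _            = 1∣ _
  product-∣ {p ∷ ps} uniq (prime[p] ∷ primes) (p∣o ∷ ps∣o) with _ ∷ uniq′ ← uniq =
    coprime⇒*-∣ (prime∤⇒coprime prime[p] (prime∤product prime[p] primes (Unique[x∷xs]⇒x∉xs uniq)))
                p∣o (product-∣ uniq′ primes ps∣o)

  product-≡mod : ∀ {ps a b} → Unique ps → All Prime ps → All (a ≡ b mod_) ps → a ≡ b mod product ps
  product-≡mod uniq primes a≡b = mod∣ (∣ᵤ⇒∣ (product-∣ uniq primes (All.map (λ (mod∣ d) → ∣⇒∣ᵤ d) a≡b)))

  split-product : ∀ {p ps} → Unique ps → All Prime ps → p ∈ ps → ∃[ m ] product ps ≡ p * m × ¬ p ∣ m
  split-product {p} {_ ∷ qs} uniq (prime[p] ∷ primes) (here refl) =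
    product qs , refl , prime∤product prime[p] primes (Unique[x∷xs]⇒x∉xs uniq)
  split-product {p} {q ∷ qs} (q∉qs ∷ uniq) (prime[q] ∷ primes) (there p∈qs)
    with m , ∏qs≡pm , p∤m ← split-product uniq primes p∈qs =
    q * m , ∏≡ , p∤qm
    where
    prime[p] = All.lookup primes p∈qs
    ∏≡ : q * product qs ≡ p * (q * m)
    ∏≡ = trans (cong (q *_) ∏qs≡pm) (trans (sym (*-assoc q p m)) (trans (cong (_* m) (*-comm q p)) (*-assoc p q m)))
    p∤qm : ¬ p ∣ q * m
    p∤qm p∣qm with euclidsLemma q m prime[p] p∣qm
    ... | inj₂ p∣m = p∤m p∣m
    ... | inj₁ p∣q with prime⇒irreducible prime[q] p∣q
    ...   | inj₁ refl = ¬prime[1] prime[p]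
    ...   | inj₂ refl = All.lookup q∉qs p∈qs refl

module ResidueLift where
  open import Data.Integer.Base using (+_; _+_; _*_; _^_; 1ℤ)
  open import Data.Integer.Properties using (pos-+; pos-*; *-identityˡ; *-identityʳ)
  open import Data.Integer.Divisibility.Signed using (∣ᵤ⇒∣; ∣⇒∣ᵤ)
  import Data.Nat.Base as ℕ
  open import Data.Nat.Divisibility using (_∣_; ∣m+n∣m⇒∣n; ∣n⇒∣m*n; ∣m⇒∣m*n)
  open import Data.Nat.Coprimality using (Coprime) renaming (sym to ⊥-sym)
  open import Data.Nat.Primality using (Prime; prime)
  open import Data.Product using (∃-syntax; _×_; _,_)
  open import Relation.Nullary using (¬_)
  open Congruence
  open PrimeModulus using (fermat-unit)
  open SquarefreeProduct using (prime∤⇒coprime; coprime-*ʳ)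

  -- The witness x·m^(p-1) + p is ≡ x mod p by Fermat, and ≡ p mod every prime factor of m.
  lift-residue : ∀ {p m x} → Prime p → ¬ p ∣ m → ¬ p ∣ x → ∃[ a ] Coprime a (p ℕ.* m) × + a ≡ + x mod p
  lift-residue {0}           (prime {{()}} _)
  lift-residue {1}           (prime {{()}} _)
  lift-residue {ℕ.suc (ℕ.suc q)} {m} {x} prime[p] p∤m p∤x =
    a , coprime-*ʳ (⊥-sym (prime∤⇒coprime prime[p] p∤a)) a⊥m , a≡x
    where
    p = ℕ.suc (ℕ.suc q)
    a = x ℕ.* m ℕ.^ ℕ.suc q ℕ.+ p
    a≡x : + a ≡ + x mod p
    a≡x = begin
      + (x ℕ.* m ℕ.^ ℕ.suc q ℕ.+ p)           ≡⟨ pos-+ (x ℕ.* m ℕ.^ ℕ.suc q) p ⟩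
      + (x ℕ.* m ℕ.^ ℕ.suc q) + + p           ≡⟨ cong₂ _+_ (trans (pos-* x _) (cong (_*_ (+ x)) (pos-^ m (ℕ.suc q))))
                                                          (sym (*-identityˡ (+ p))) ⟩
      + x * (+ m) ^ ℕ.suc q + 1ℤ * + p        ≈⟨ +-*-≡mod _ 1ℤ ⟩
      + x * (+ m) ^ ℕ.suc q                   ≈⟨ *-congˡ-≡mod (+ x) (fermat-unit prime[p] p∤m) ⟩
      + x * 1ℤ                                ≡⟨ *-identityʳ (+ x) ⟩
      + x                                     ∎
      where open ≡mod-Reasoning p
    p∤a : ¬ p ∣ a
    p∤a p∣a = p∤x (∣⇒∣ᵤ (∣-resp-≡mod a≡x (∣ᵤ⇒∣ p∣a)))
    a⊥m : Coprime a m
    a⊥m (d∣a , d∣m) =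
      prime∤⇒coprime prime[p] p∤m (∣m+n∣m⇒∣n d∣a (∣n⇒∣m*n x (∣m⇒∣m*n (m ℕ.^ q) d∣m)) , d∣m)

module CarmichaelLambda where
  open import Defs using (KillsUnits; IsCarmichaelLambda)
  open import Data.Integer.Base using (+_; _*_; _^_; 1ℤ)
  open import Data.Integer.Properties using (*-identityʳ; ^-*-assoc; ^-distribˡ-+-*)
  import Data.Nat.Base as ℕ
  import Data.Nat.Properties as ℕ
  open import Data.Nat.Divisibility using (_∣_; m%n≡0⇒n∣m)
  open import Data.Nat.DivMod using (_%_; _/_; m≡m%n+[m/n]*n; m%n<n)
  open import Data.Nat.Coprimality using (Coprime)
  open import Data.Product using (_,_)
  open import Relation.Nullary using (contradiction)
  open Congruence

  module _ {n : ℕ} .{{_ : NonZero n}} where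

    kills⇒≡1 : ∀ ℓ {a} → KillsUnits n ℓ → Coprime a n → (+ a) ^ ℓ ≡ 1ℤ mod n
    kills⇒≡1 ℓ {a} kills a⊥n = subst (_≡ 1ℤ mod n) (pos-^ a ℓ) (%≡%⇒≡mod (kills a a⊥n))

    ≡1⇒kills : ∀ ℓ → (∀ {a} → Coprime a n → (+ a) ^ ℓ ≡ 1ℤ mod n) → KillsUnits n ℓ
    ≡1⇒kills ℓ ≡1 a a⊥n = ≡mod⇒%≡% (subst (_≡ 1ℤ mod n) (sym (pos-^ a ℓ)) (≡1 a⊥n))

    %-kills : ∀ ℓ M .{{_ : NonZero ℓ}} → KillsUnits n ℓ → KillsUnits n M → KillsUnits n (M % ℓ)
    %-kills ℓ M kills-ℓ kills-M = ≡1⇒kills (M % ℓ) (λ {a} → unit a)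
      where
      unit : ∀ a → Coprime a n → (+ a) ^ (M % ℓ) ≡ 1ℤ mod n
      unit a a⊥n = begin
        y ^ (M % ℓ)                         ≡⟨ sym (*-identityʳ _) ⟩
        y ^ (M % ℓ) * 1ℤ                    ≈⟨ *-congˡ-≡mod (y ^ (M % ℓ)) (≡mod-sym y^ℓq≡1) ⟩
        y ^ (M % ℓ) * (y ^ ℓ) ^ (M / ℓ)     ≡⟨ cong (y ^ (M % ℓ) *_) (^-*-assoc y ℓ (M / ℓ)) ⟩
        y ^ (M % ℓ) * y ^ (ℓ ℕ.* (M / ℓ))   ≡⟨ sym (^-distribˡ-+-* y (M % ℓ) _) ⟩
        y ^ (M % ℓ ℕ.+ ℓ ℕ.* (M / ℓ))       ≡⟨ cong (λ e → y ^ (M % ℓ ℕ.+ e)) (ℕ.*-comm ℓ (M / ℓ)) ⟩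
        y ^ (M % ℓ ℕ.+ M / ℓ ℕ.* ℓ)         ≡⟨ cong (y ^_) (sym (m≡m%n+[m/n]*n M ℓ)) ⟩
        y ^ M                               ≈⟨ kills⇒≡1 M kills-M a⊥n ⟩
        1ℤ                                  ∎
        where open ≡mod-Reasoning n
              y = + a
              y^ℓq≡1 : (y ^ ℓ) ^ (M / ℓ) ≡ 1ℤ mod n
              y^ℓq≡1 = ≡1⇒^≡1 (M / ℓ) (kills⇒≡1 ℓ kills-ℓ a⊥n)

    λ∣ : ∀ {L M} → IsCarmichaelLambda n L → KillsUnits n M → L ∣ M
    λ∣ {L} {M} (0<L , kills-L , least) kills-M = m%n≡0⇒n∣m M L M%L≡0
      where
      instance _ = ℕ.>-nonZero 0<L
      M%L≡0 : M % L ≡ 0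
      M%L≡0 with M % L in M%L≡r
      ... | ℕ.zero  = refl
      ... | ℕ.suc r = contradiction (least (ℕ.suc r) ℕ.z<s (subst (KillsUnits n) M%L≡r (%-kills L M kills-L kills-M)))
                                    (ℕ.<⇒≱ (subst (ℕ._< L) M%L≡r (m%n<n M L)))

module Counting where
  open import Data.Integer.Base using (+_; _*_; 1ℤ)
  open import Data.Integer.Properties using (pos-*; *-identityˡ; *-identityʳ)
  open import Data.Nat.Base using (suc; _≤_; _∸_)
  open import Data.Nat.Properties using (suc-injective; ≤∧≢⇒<; m+n≤o⇒m≤o∸n; +-comm)
  import Data.Nat.Base as ℕ
  import Data.Nat.Properties as ℕ
  open import Data.Nat.ListAction using (product)
  open import Data.List.Base using (List; []; _∷_; length; filter)
  open import Data.List.Properties using (filter-complete)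
  open import Data.List.Membership.Propositional using (_∈_)
  open import Data.List.Relation.Unary.Any using (here; there)
  open import Data.List.Relation.Unary.All as All using (All; []; _∷_)
  open import Data.List.Relation.Unary.All.Properties using (all-filter)
  open import Data.Product using (∃-syntax; _×_; _,_)
  open import Data.Sum using (_⊎_; inj₁; inj₂)
  open import Relation.Nullary using (¬_; yes; no)
  open import Relation.Unary using (Pred; Decidable)
  open Congruence

  product-≡1 : ∀ {m xs} → All (λ x → + x ≡ 1ℤ mod m) xs → + product xs ≡ 1ℤ mod m
  product-≡1 []                       = ≡mod-refl
  product-≡1 {m} {x ∷ xs} (x≡1 ∷ xs≡1) = begin
    + (x ℕ.* product xs)     ≡⟨ pos-* x (product xs) ⟩
    + x * + product xs       ≈⟨ *-cong-≡mod x≡1 (product-≡1 xs≡1) ⟩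
    1ℤ                       ∎
    where open ≡mod-Reasoning m

  module _ {p} {P : Pred ℕ p} (P? : Decidable P) {m : ℕ} where

    sole-exception : ∀ xs → All (λ x → P x → + x ≡ 1ℤ mod m) xs → suc (length (filter P? xs)) ≡ length xs →
                     ∃[ q ] q ∈ xs × ¬ P q × + product xs ≡ + q mod m
    sole-exception (x ∷ xs) (x≡1 ∷ xs≡1) |xs| with P? x
    ... | yes Px with q , q∈xs , ¬Pq , ∏xs≡q ← sole-exception xs xs≡1 (suc-injective |xs|) =
      q , there q∈xs , ¬Pq , (begin
        + (x ℕ.* product xs)     ≡⟨ pos-* x (product xs) ⟩
        + x * + product xs       ≈⟨ *-cong-≡mod (x≡1 Px) ∏xs≡q ⟩
        1ℤ * + q                 ≡⟨ *-identityˡ (+ q) ⟩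
        + q                      ∎)
      where open ≡mod-Reasoning m
    ... | no ¬Px = x , here refl , ¬Px , (begin
        + (x ℕ.* product xs)     ≡⟨ pos-* x (product xs) ⟩
        + x * + product xs       ≈⟨ *-congˡ-≡mod (+ x) (product-≡1 xs≡1′) ⟩
        + x * 1ℤ                 ≡⟨ *-identityʳ (+ x) ⟩
        + x                      ∎)
      where
      open ≡mod-Reasoning m
      xs≡1′ : All (λ x → + x ≡ 1ℤ mod m) xs
      xs≡1′ = All.zipWith (λ (x≡1 , Px) → x≡1 Px)
        (xs≡1 , subst (All P) (filter-complete P? (suc-injective |xs|)) (all-filter P? xs))

  gap-below-top : ∀ {h k} → 1 ≤ h → h ≤ k → suc h ≢ k → (1 ≤ h × h ≤ k ∸ 2) ⊎ h ≡ k
  gap-below-top {h} {k} 1≤h h≤k 1+h≢k with h ℕ.≟ k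
  ... | yes h≡k = inj₂ h≡k
  ... | no  h≢k =
    inj₁ (1≤h , m+n≤o⇒m≤o∸n h (subst (_≤ k) (+-comm 2 h) (≤∧≢⇒< (≤∧≢⇒< h≤k h≢k) 1+h≢k)))

module Carmichael {ps : List ℕ} (uniq : Unique ps) (primes : All Prime ps)
                  {n : ℕ} .{{_ : NonZero n}} (n≡∏ps : n ≡ product ps)
                  {L : ℕ} (isλ : IsCarmichaelLambda n L) where
  open import Data.Nat.Base
  open import Data.Nat.Properties
  open import Data.Nat.Divisibility using (_∣_; ∣⇒≤; ∣-trans)
  open import Data.Nat.Coprimality using (Coprime)
  open import Data.Nat.Primality using (Composite; ¬prime[1]; prime⇒nonTrivial; composite⇒nonTrivial)
  open import Data.Nat.ListAction.Properties using (∈⇒∣product)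
  import Data.Integer.Base as ℤ
  open import Data.Integer.Base using (+_; 1ℤ)
  open import Data.List.Base using (length; filter)
  open import Data.List.Properties using (filter-some)
  open import Data.List.Membership.Propositional using (_∈_; find; lose)
  open import Data.List.Relation.Unary.Any using (Any; here)
  import Data.List.Relation.Unary.All as All
  open import Data.List.Relation.Unary.All.Properties.Core using (¬All⇒Any¬)
  open import Data.Bool.Base using (T)
  open import Relation.Nullary.Decidable using (T?)
  open import Relation.Unary using (Decidable)
  open import Data.Product using (∃-syntax; _×_; _,_; proj₁; proj₂)
  open import Relation.Nullary using (¬_; contradiction)
  open Congruence
  open PrimeModulus using (fermat-unit; ¬x^d≡1-on-[1,1+d])
  open TwoAdic
  open ExponentHalving using (halve-exponent)
  open SquarefreeProduct using (split-product; product-≡mod)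
  open ResidueLift using (lift-residue)
  open CarmichaelLambda
  open Counting using (sole-exception)

  N : ℕ
  N = v₂ L

  private
    0<L : 0 < L
    0<L = proj₁ isλ
    kills-L : KillsUnits n L
    kills-L = proj₁ (proj₂ isλ)
    L-least : ∀ ℓ → 0 < ℓ → KillsUnits n ℓ → L ≤ ℓ
    L-least = proj₂ (proj₂ isλ)
    L-decomposition : ∃[ o ] Odd o × L ≡ 2 ^ N * o
    L-decomposition = v₂-decomposition 0<L

  r : ℕ
  r = proj₁ L-decomposition

  r-odd : Odd r
  r-odd = proj₁ (proj₂ L-decomposition)

  L≡2^N*r : L ≡ 2 ^ N * r
  L≡2^N*r = proj₂ (proj₂ L-decomposition)

  module _ {p : ℕ} (p∈ps : p ∈ ps) where
    private
      prime[p] : Prime p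
      prime[p] = All.lookup primes p∈ps
      p∣n : p ∣ n
      p∣n = subst (p ∣_) (sym n≡∏ps) (∈⇒∣product p∈ps)
      1<p : 1 < p
      1<p = nonTrivial⇒n>1 p {{prime⇒nonTrivial prime[p]}}
      0<p∸1 : 0 < p ∸ 1
      0<p∸1 = m<n⇒0<n∸m 1<p

    unit⇒p∤ : ∀ {a} → Coprime a n → ¬ p ∣ a
    unit⇒p∤ a⊥n p∣a = ¬prime[1] (subst Prime (a⊥n (p∣a , p∣n)) prime[p])

    λ-kills-mod-p : ∀ {a} → Coprime a n → (+ a) ℤ.^ (2 ^ N * r) ≡ 1ℤ mod p
    λ-kills-mod-p {a} a⊥n =
      subst (λ e → (+ a) ℤ.^ e ≡ 1ℤ mod p) L≡2^N*r (∣-weaken-≡mod p∣n (kills⇒≡1 L kills-L a⊥n))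

    fermat-mod-p : ∀ {a} → Coprime a n → (+ a) ℤ.^ (p ∸ 1) ≡ 1ℤ mod p
    fermat-mod-p a⊥n = fermat-unit prime[p] (unit⇒p∤ a⊥n)

    ≡1-on-units⇒≡1-on-residues : ∀ {k x} → (∀ {a} → Coprime a n → (+ a) ℤ.^ k ≡ 1ℤ mod p) →
                                 ¬ p ∣ x → (+ x) ℤ.^ k ≡ 1ℤ mod p
    ≡1-on-units⇒≡1-on-residues {k} ≡1 p∤x
      with m , ∏ps≡pm , p∤m ← split-product uniq primes p∈ps
      with a , a⊥pm , a≡x ← lift-residue prime[p] p∤m p∤x
      = ≡mod-trans (^-cong-≡mod k (≡mod-sym a≡x)) (≡1 (subst (Coprime a) (sym (trans n≡∏ps ∏ps≡pm)) a⊥pm))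

    ¬v₂λ<v₂[p∸1] : ¬ N < v₂ (p ∸ 1)
    ¬v₂λ<v₂[p∸1] N<e with v₂ (p ∸ 1) | v₂-decomposition 0<p∸1
    ... | zero   | _ = contradiction N<e n≮0
    ... | suc e′ | m , m-odd , p∸1≡2^[1+e′]m = ¬x^d≡1-on-[1,1+d] prime[p] 0<d 1+d<p x^d≡1
      where
      d = 2 ^ e′ * m
      0<d : 0 < d
      0<d = *-mono-≤ (m^n>0 2 e′) (odd⇒>0 m-odd)
      1+d<p : suc d < p
      1+d<p = begin-strict
        suc d              <⟨ s≤s (+-monoˡ-≤ d 0<d) ⟩
        suc (d + d)        ≡⟨ cong (λ x → suc (d + x)) (sym (+-identityʳ d)) ⟩
        suc (2 * d)        ≡⟨ +-comm 1 (2 * d) ⟩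
        2 * d + 1          ≡⟨ cong (_+ 1) (trans (sym (*-assoc 2 (2 ^ e′) m)) (sym p∸1≡2^[1+e′]m)) ⟩
        p ∸ 1 + 1          ≡⟨ m∸n+n≡m (<⇒≤ 1<p) ⟩
        p                  ∎
        where open ≤-Reasoning
      unit^d≡1 : ∀ {a} → Coprime a n → (+ a) ℤ.^ d ≡ 1ℤ mod p
      unit^d≡1 {a} a⊥n = halve-exponent e′ (≤-pred N<e) r-odd
        (subst (λ e → (+ a) ℤ.^ e ≡ 1ℤ mod p) p∸1≡2^[1+e′]m (fermat-mod-p a⊥n)) (λ-kills-mod-p a⊥n)
      x^d≡1 : ∀ x → 0 < x → x ≤ suc d → (+ x) ℤ.^ d ≡ 1ℤ mod p
      x^d≡1 x 0<x x≤1+d = ≡1-on-units⇒≡1-on-residues {d} unit^d≡1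
        (λ p∣x → <⇒≱ (≤-<-trans x≤1+d 1+d<p) (∣⇒≤ {{>-nonZero 0<x}} p∣x))

    v₂[p∸1]≤v₂λ : v₂ (p ∸ 1) ≤ N
    v₂[p∸1]≤v₂λ = ≮⇒≥ ¬v₂λ<v₂[p∸1]

    v₂[p∸1]<v₂λ⇒halfλ-kills : ∀ {N′ a} → N ≡ suc N′ → v₂ (p ∸ 1) < N → Coprime a n →
                              (+ a) ℤ.^ (2 ^ N′ * r) ≡ 1ℤ mod p
    v₂[p∸1]<v₂λ⇒halfλ-kills {N′} {a} N≡1+N′ e<N a⊥n
      with m , m-odd , p∸1≡2^e*m ← v₂-decomposition 0<p∸1
      = halve-exponent N′ (≤-pred (subst (v₂ (p ∸ 1) <_) N≡1+N′ e<N)) m-odd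
          (subst (λ k → (+ a) ℤ.^ (2 ^ k * r) ≡ 1ℤ mod p) N≡1+N′ (λ-kills-mod-p a⊥n))
          (subst (λ e → (+ a) ℤ.^ e ≡ 1ℤ mod p) p∸1≡2^e*m (fermat-mod-p a⊥n))

    v₂[p∸1]≡v₂λ⇒≡1 : v₂ (p ∸ 1) ≡ N → + p ≡ 1ℤ mod 2 ^ N
    v₂[p∸1]≡v₂λ⇒≡1 e≡N = ∣∸1⇒≡1 (<⇒≤ 1<p) (subst (λ k → 2 ^ k ∣ p ∸ 1) e≡N (2^v₂∣ 0<p∸1))

    ≡1⇒v₂λ≤v₂[p∸1] : + p ≡ 1ℤ mod 2 ^ N → N ≤ v₂ (p ∸ 1)
    ≡1⇒v₂λ≤v₂[p∸1] p≡1 = 2^a∣⇒a≤v₂ 0<p∸1 (≡1⇒∣∸1 (<⇒≤ 1<p) p≡1)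

  ¬all-v₂[p∸1]<v₂λ : ∀ {q} → q ∈ ps → ¬ All (λ p → v₂ (p ∸ 1) < N) ps
  ¬all-v₂[p∸1]<v₂λ q∈ps all< = <⇒≱ ℓ<L (L-least ℓ 0<ℓ kills-ℓ)
    where
    0<N : 0 < N
    0<N = ≤-<-trans z≤n (All.lookup all< q∈ps)
    N′ = pred N
    N≡1+N′ : N ≡ suc N′
    N≡1+N′ = sym (suc-pred N {{>-nonZero 0<N}})
    ℓ = 2 ^ N′ * r
    0<ℓ : 0 < ℓ
    0<ℓ = *-mono-≤ (m^n>0 2 N′) (odd⇒>0 r-odd)
    ℓ<L : ℓ < L
    ℓ<L = begin-strict
      ℓ                 <⟨ m<m+n ℓ 0<ℓ ⟩
      ℓ + ℓ             ≡⟨ cong (_+_ ℓ) (sym (+-identityʳ ℓ)) ⟩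
      2 * ℓ             ≡⟨ sym (*-assoc 2 (2 ^ N′) r) ⟩
      2 ^ suc N′ * r    ≡⟨ cong (λ k → 2 ^ k * r) (sym N≡1+N′) ⟩
      2 ^ N * r         ≡⟨ sym L≡2^N*r ⟩
      L                 ∎
      where open ≤-Reasoning
    kills-ℓ : KillsUnits n ℓ
    kills-ℓ = ≡1⇒kills ℓ λ {a} a⊥n → subst ((+ a) ℤ.^ ℓ ≡ 1ℤ mod_) (sym n≡∏ps) (product-≡mod uniq primes
      (All.tabulate λ p∈ps → v₂[p∸1]<v₂λ⇒halfλ-kills p∈ps N≡1+N′ (All.lookup all< p∈ps) a⊥n))

  attains-v₂λ? : Decidable (λ p → T (v₂ (p ∸ 1) ≡ᵇ N))
  attains-v₂λ? p = T? (v₂ (p ∸ 1) ≡ᵇ N)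

  h : ℕ
  h = length (filter attains-v₂λ? ps)

  1≤h : Composite n → 1 ≤ h
  1≤h composite = filter-some attains-v₂λ? (attained (find (¬All⇒Any¬ (λ p → v₂ (p ∸ 1) <? N) ps
                                                          (¬all-v₂[p∸1]<v₂λ (proj₂ (some-factor ps n≡∏ps))))))
    where
    some-factor : ∀ qs → n ≡ product qs → ∃[ q ] q ∈ qs
    some-factor []      n≡1 = contradiction n≡1 (>⇒≢ (nonTrivial⇒n>1 n {{composite⇒nonTrivial composite}}))
    some-factor (q ∷ _) _   = q , here refl
    attained : (∃[ p ] p ∈ ps × ¬ v₂ (p ∸ 1) < N) → Any (λ p → T (v₂ (p ∸ 1) ≡ᵇ N)) ps
    attained (p , p∈ps , e≮N) = lose p∈ps (≡⇒≡ᵇ (v₂ (p ∸ 1)) N (≤∧≮⇒≡ (v₂[p∸1]≤v₂λ p∈ps) e≮N))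

  1+h≢k : IsCarmichael n → suc h ≢ length ps
  1+h≢k (_ , fermat-n) 1+h≡k = refute (sole-exception attains-v₂λ? ps attaining⇒≡1 1+h≡k)
    where
    attaining⇒≡1 : All (λ p → T (v₂ (p ∸ 1) ≡ᵇ N) → + p ≡ 1ℤ mod 2 ^ N) ps
    attaining⇒≡1 = All.tabulate λ {p} p∈ps attains → v₂[p∸1]≡v₂λ⇒≡1 p∈ps (≡ᵇ⇒≡ (v₂ (p ∸ 1)) N attains)
    n≡1 : + n ≡ 1ℤ mod 2 ^ N
    n≡1 = ∣∸1⇒≡1 (>-nonZero⁻¹ n) (∣-trans (2^v₂∣ 0<L) (λ∣ isλ fermat-n))
    refute : ¬ (∃[ q ] q ∈ ps × ¬ T (v₂ (q ∸ 1) ≡ᵇ N) × + product ps ≡ + q mod 2 ^ N)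
    refute (q , q∈ps , q-misses , ∏ps≡q) =
      q-misses (≡⇒≡ᵇ (v₂ (q ∸ 1)) N (≤-antisym (v₂[p∸1]≤v₂λ q∈ps) (≡1⇒v₂λ≤v₂[p∸1] q∈ps q≡1)))
      where
      q≡1 : + q ≡ 1ℤ mod 2 ^ N
      q≡1 = ≡mod-trans (≡mod-sym ∏ps≡q) (subst (λ m → + m ≡ 1ℤ mod 2 ^ N) n≡∏ps n≡1)

open import Data.Nat.Base using (_∸_; _≤_; _≡ᵇ_)
open import Data.Nat.Divisibility using (_∣_)
open import Data.List.Base using (length; filterᵇ)
open import Data.List.Properties using (length-filter)
open import Data.Product using (_×_; proj₁)
open import Data.Sum using (_⊎_)
open import Relation.Nullary using (¬_)
open Counting using (gap-below-top)

mainTheorem4 : (ps : List ℕ) → Unique ps → All Prime ps → All (λ p → ¬ (2 ∣ p)) ps →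
    (n : ℕ) → .{{_ : NonZero n}} → n ≡ product ps → IsCarmichael n →
    (L : ℕ) → IsCarmichaelLambda n L →
    let k = length ps
        h = length (filterᵇ (λ p → v₂ (p ∸ 1) ≡ᵇ v₂ L) ps)
    in (1 ≤ h × h ≤ k ∸ 2) ⊎ h ≡ k
-- The primes need not be odd for this argument.
mainTheorem4 ps uniq primes _ n n≡∏ps carmichael L isλ =
  gap-below-top (1≤h (proj₁ carmichael)) (length-filter attains-v₂λ? ps) (1+h≢k carmichael)
  where open Carmichael uniq primes n≡∏ps isλ
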